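{- Let $q$ be a power of $2$. The Gauss group is cyclic of order $2q$. If $I$ is an ideal of $\mathbb{Z}[i]$ whose norm is $\equiv5\pmod 8$, then the Gauss-class of $I$ generates the Gauss group.
   Context: Every ideal of $\mathbb{Z}[i]$ of odd norm has a generator $a+2bi$ with $a,b\in\mathbb{Z}$, $a$ odd, unique up to sign. Two such ideals $(\alpha)$, $(\beta)$ (generators of this form) are Gauss-equivalent if there is an integer $N$ with $N\alpha\equiv\beta\pmod{4q\mathbb{Z}[i]}$; the equivalence classes are called Gauss-classes. Products of an ideal in a class $R_1$ and an ideal in a class $R_2$ all lie in one Gauss-class, giving a multiplication on Gauss-classes; with it the Gauss-classes form a group, the Gauss group. -}

module Defs where

open import Data.Nat using (ℕ; zero; suc; _<_; _^_)
  renaming (_*_ to _*ℕ_)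
open import Data.Integer using (ℤ; +_; _+_; _-_; _*_)
open import Data.Integer.Divisibility using (_∣_)
open import Data.Product using (Σ; ∃-syntax; _×_; proj₁)
open import Relation.Nullary using (¬_)
open import Relation.Binary.PropositionalEquality using (_≡_)

-- A Gaussian integer of the shape  a + 2 b i  (a, b ∈ ℤ), stored as the pair (a , b).
record Gen : Set where
  constructor gen
  field
    re   : ℤ
    half : ℤ
open Gen public

OddInt : ℤ → Set
OddInt a = ¬ (+ 2 ∣ a)

-- An ideal of ℤ[i] of odd norm, represented by a generator a + 2bi with a odd
-- (such a generator exists and is unique up to sign).
OddNormIdeal : Set
OddNormIdeal = Σ Gen (λ α → OddInt (re α))

norm : Gen → ℤ
norm (gen a b) = a * a + + 4 * (b * b)

-- Product of Gaussian integers:  (a + 2bi)(c + 2di) = (ac - 4bd) + 2(ad + bc)i.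
_·_ : Gen → Gen → Gen
gen a b · gen c d = gen (a * c - + 4 * (b * d)) (a * d + b * c)

one : Gen
one = gen (+ 1) (+ 0)

pow : Gen → ℕ → Gen
pow g zero    = one
pow g (suc k) = pow g k · g

-- Gauss-equivalence of generators modulo 4q:
-- ∃ N ∈ ℤ with N α ≡ β (mod 4q ℤ[i]), i.e. 4q ∣ N a - a' and 4q ∣ 2(N b) - 2 b'.
GaussEquiv : ℕ → Gen → Gen → Set
GaussEquiv q (gen a b) (gen a' b') =
  ∃[ N ] ((+ (4 *ℕ q) ∣ (N * a - a')) × (+ (4 *ℕ q) ∣ (+ 2 * (N * b) - + 2 * b')))

GeneratesWithOrder : ℕ → ℕ → Gen → Set
GeneratesWithOrder q n g =
  ((I : OddNormIdeal) → ∃[ k ] (k < n × GaussEquiv q (pow g k) (proj₁ I)))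
  × (∀ k l → k < n → l < n → GaussEquiv q (pow g k) (pow g l) → k ≡ l)

GaussGroupCyclicOfOrder : ℕ → ℕ → Set
GaussGroupCyclicOfOrder q n = Σ OddNormIdeal (λ I → GeneratesWithOrder q n (proj₁ I))

-- Write the generators as a + 2bi and put cross (a + 2bi) (c + 2di) = ad - bc. As a is odd,
-- hence invertible modulo 4q, two generators are Gauss-equivalent exactly when 4q divides twice
-- their cross. Let g = a + 2bi with a and b odd: g = 1 + 2i is one, and norm ≡ 5 (mod 8) forces
-- b to be odd. Since half (g^(2e)) = 2 re (g^e) half (g^e) and half (g^d) is odd for odd d, the
-- power of 2 dividing half (g^d) is the one dividing d; as cross (g^k) (g^(k+d)) = norm (g^k) half (g^d)
-- with an odd norm, the classes of g^0, ..., g^(2q-1) are distinct. They exhaust the group: by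
-- induction on n there is k < 2^n with 2^n dividing cross (g^k) γ, and when the quotient is odd,
-- k + 2^n works at the next level because half (g^(2^n)) is 2^n times an odd number.
module Submission where

open import Defs

module _ where

  open import Data.Nat as ℕ using (zero; suc; z≤n; s≤s)
  import Data.Nat.Properties as ℕₚ
  open import Data.Nat.Divisibility using (∣⇒≤; ∣1⇒≡1)
  open import Data.Integer using (ℤ; +_; _+_; _-_; -_; _*_; _^_; _/_; _%_)
  open import Data.Integer.Properties
    using (*-comm; *-assoc; *-identityˡ; *-identityʳ; +-identityˡ; +-identityʳ; pos-*; pos-+)
  open import Data.Integer.DivMod using (a≡a%n+[a/n]*n; n%d<d)
  open import Data.Integer.Divisibility.Signed
    using (_∣_; divides; ∣-refl; ∣-trans; ∣m∣n⇒∣m-n; ∣m+n∣n⇒∣m; ∣m⇒∣-m; ∣n⇒∣m*n; ∣m⇒∣m*n;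
           *-monoʳ-∣; *-cancelˡ-∣; ∣⇒∣ᵤ; ∣ᵤ⇒∣)
  open import Data.Integer.Divisibility using () renaming (_∣_ to _∣ᵤ_)
  open import Data.Integer.Tactic.RingSolver using (solve-∀; solve)
  open import Data.List using (_∷_; [])
  open import Data.Product using (∃-syntax; _×_; _,_; proj₁)
  open import Data.Sum using (_⊎_; inj₁; inj₂)
  open import Data.Empty using (⊥-elim)
  open import Relation.Nullary using (¬_)
  open import Relation.Binary.PropositionalEquality
    using (_≡_; refl; sym; trans; cong; cong₂; subst; module ≡-Reasoning)
  open ≡-Reasoning

  Odd : ℤ → Set
  Odd x = ∃[ w ] x ≡ + 1 + + 2 * w

  even⊎odd : ∀ x → + 2 ∣ x ⊎ Odd x
  even⊎odd x with x % + 2 | n%d<d x (+ 2) | a≡a%n+[a/n]*n x (+ 2)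
  ... | 0           | _            | eq = inj₁ (divides (x / + 2) (trans eq (+-identityˡ _)))
  ... | 1           | _            | eq = inj₂ (x / + 2 , trans eq (cong (_+_ (+ 1)) (*-comm (x / + 2) (+ 2))))
  ... | suc (suc _) | s≤s (s≤s ()) | _

  ℕ-even⊎odd : ∀ d → (∃[ e ] d ≡ e ℕ.+ e) ⊎ (∃[ e ] d ≡ suc (e ℕ.+ e))
  ℕ-even⊎odd zero = inj₁ (0 , refl)
  ℕ-even⊎odd (suc d) with ℕ-even⊎odd d
  ... | inj₁ (e , refl) = inj₂ (e , refl)
  ... | inj₂ (e , refl) = inj₁ (suc e , cong suc (sym (ℕₚ.+-suc e e)))

  odd⇒¬even : ∀ {x} → Odd x → ¬ (+ 2 ∣ x)
  odd⇒¬even (w , refl) 2∣x with ∣1⇒≡1 (∣⇒∣ᵤ (∣m+n∣n⇒∣m {m = + 1} 2∣x (∣m⇒∣m*n w ∣-refl)))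
  ... | ()

  oddInt⇒odd : ∀ {a} → OddInt a → Odd a
  oddInt⇒odd {a} ¬2∣a with even⊎odd a
  ... | inj₁ 2∣a = ⊥-elim (¬2∣a (∣⇒∣ᵤ 2∣a))
  ... | inj₂ odd = odd

  odd⇒oddInt : ∀ {a} → Odd a → OddInt a
  odd⇒oddInt odd 2∣a = odd⇒¬even odd (∣ᵤ⇒∣ 2∣a)

  odd-* : ∀ {x y} → Odd x → Odd y → Odd (x * y)
  odd-* (w , refl) (v , refl) = w + v + + 2 * (w * v) , expand w v
    where
    expand : ∀ w v → (+ 1 + + 2 * w) * (+ 1 + + 2 * v) ≡ + 1 + + 2 * (w + v + + 2 * (w * v))
    expand = solve-∀

  odd+even : ∀ {x y} → Odd x → + 2 ∣ y → Odd (x + y)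
  odd+even (w , refl) (divides q refl) = w + q , regroup w q
    where
    regroup : ∀ w q → + 1 + + 2 * w + q * + 2 ≡ + 1 + + 2 * (w + q)
    regroup = solve-∀

  2∣odd-odd : ∀ {x y} → Odd x → Odd y → + 2 ∣ x - y
  2∣odd-odd (w , refl) (v , refl) = divides (w - v) (regroup w v)
    where
    regroup : ∀ w v → + 1 + + 2 * w - (+ 1 + + 2 * v) ≡ (w - v) * + 2
    regroup = solve-∀

  2∣4* : ∀ x → + 2 ∣ + 4 * x
  2∣4* x = ∣m⇒∣m*n x (divides (+ 2) refl)

  2∣x*x-1⇒odd : ∀ x → + 2 ∣ x * x - + 1 → Odd x
  2∣x*x-1⇒odd x 2∣x*x-1 with even⊎odd x
  ... | inj₂ odd = odd
  ... | inj₁ 2∣x = ⊥-elim (odd⇒¬even (+ 0 , refl)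
                     (subst (+ 2 ∣_) (cancel (x * x)) (∣m∣n⇒∣m-n (∣m⇒∣m*n x 2∣x) 2∣x*x-1)))
    where
    cancel : ∀ y → y - (y - + 1) ≡ + 1
    cancel = solve-∀

  2∣w*[w+1] : ∀ w → + 2 ∣ w * (w + + 1)
  2∣w*[w+1] w with even⊎odd w
  ... | inj₁ 2∣w = ∣m⇒∣m*n (w + + 1) 2∣w
  ... | inj₂ (v , refl) = ∣n⇒∣m*n (+ 1 + + 2 * v) (divides (v + + 1) (regroup v))
    where
    regroup : ∀ v → + 1 + + 2 * v + + 1 ≡ (v + + 1) * + 2
    regroup = solve-∀

  8∣odd*odd-1 : ∀ {a} → Odd a → + 8 ∣ a * a - + 1
  8∣odd*odd-1 (w , refl) = subst (+ 8 ∣_) (sym (expand w)) (*-monoʳ-∣ (+ 4) (2∣w*[w+1] w))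
    where
    expand : ∀ w → (+ 1 + + 2 * w) * (+ 1 + + 2 * w) - + 1 ≡ + 4 * (w * (w + + 1))
    expand = solve-∀

  pos-2^ : ∀ n → + (2 ℕ.^ n) ≡ (+ 2) ^ n
  pos-2^ zero    = refl
  pos-2^ (suc n) = trans (pos-* 2 (2 ℕ.^ n)) (cong (+ 2 *_) (pos-2^ n))

  2∣2^suc : ∀ n → + 2 ∣ (+ 2) ^ suc n
  2∣2^suc n = ∣m⇒∣m*n ((+ 2) ^ n) ∣-refl

  ∣∧<⇒≡0 : ∀ {m d} → d ℕ.< m → + m ∣ + d → d ≡ 0
  ∣∧<⇒≡0 {d = zero}  _   _   = refl
  ∣∧<⇒≡0 {d = suc d} d<m m∣d = ⊥-elim (ℕₚ.<⇒≱ d<m (∣⇒≤ (∣⇒∣ᵤ m∣d)))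

  2^n∣odd*x⇒2^n∣x : ∀ n {a x} → Odd a → (+ 2) ^ n ∣ a * x → (+ 2) ^ n ∣ x
  2^n∣odd*x⇒2^n∣x zero    {x = x} _ _ = divides x (sym (*-identityʳ x))
  2^n∣odd*x⇒2^n∣x (suc n) {a} {x} odd-a ∣a*x with even⊎odd x
  ... | inj₂ odd-x = ⊥-elim (odd⇒¬even (odd-* odd-a odd-x) (∣-trans (2∣2^suc n) ∣a*x))
  ... | inj₁ (divides y refl) =
    subst ((+ 2) ^ suc n ∣_) (*-comm (+ 2) y)
      (*-monoʳ-∣ (+ 2) (2^n∣odd*x⇒2^n∣x n odd-a
        (*-cancelˡ-∣ (+ 2) (subst ((+ 2) ^ suc n ∣_) (regroup a y) ∣a*x))))
    where
    regroup : ∀ a y → a * (y * + 2) ≡ + 2 * (a * y)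
    regroup = solve-∀

  2P∣x-1⇒4P∣x*x-1 : ∀ {P x} → + 2 * P ∣ x - + 1 → + 2 * (+ 2 * P) ∣ x * x - + 1
  2P∣x-1⇒4P∣x*x-1 {P} {x} (divides t eq) = divides (t * (t * P + + 1)) (begin
    x * x - + 1                            ≡⟨ factor x ⟩
    (x - + 1) * (x - + 1 + + 2)            ≡⟨ cong (λ y → y * (y + + 2)) eq ⟩
    t * (+ 2 * P) * (t * (+ 2 * P) + + 2)  ≡⟨ regroup t P ⟩
    t * (t * P + + 1) * (+ 2 * (+ 2 * P))  ∎)
    where
    factor : ∀ x → x * x - + 1 ≡ (x - + 1) * (x - + 1 + + 2)
    factor = solve-∀
    regroup : ∀ t P → t * (+ 2 * P) * (t * (+ 2 * P) + + 2) ≡ t * (t * P + + 1) * (+ 2 * (+ 2 * P))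
    regroup = solve-∀

  odd-invertible-mod-2^ : ∀ {a} → Odd a → ∀ n → ∃[ r ] (+ 2) ^ suc n ∣ r * a - + 1
  odd-invertible-mod-2^ {a} odd-a zero =
    + 1 , subst (λ y → + 2 ∣ y - + 1) (sym (*-identityˡ a)) (2∣odd-odd odd-a (+ 0 , refl))
  odd-invertible-mod-2^ {a} odd-a (suc n) with odd-invertible-mod-2^ odd-a n
  ... | r , ∣r*a-1 =
    r * r * a ,
    subst (λ y → (+ 2) ^ suc (suc n) ∣ y - + 1) (sym (regroup r a)) (2P∣x-1⇒4P∣x*x-1 {x = r * a} ∣r*a-1)
    where
    regroup : ∀ r a → r * r * a * a ≡ r * a * (r * a)
    regroup = solve-∀

  ·-assoc : ∀ x y z → (x · y) · z ≡ x · (y · z)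
  ·-assoc (gen a b) (gen c d) (gen e f) = cong₂ gen (re-assoc a b c d e f) (half-assoc a b c d e f)
    where
    re-assoc : ∀ a b c d e f →
      (a * c - + 4 * (b * d)) * e - + 4 * ((a * d + b * c) * f) ≡
      a * (c * e - + 4 * (d * f)) - + 4 * (b * (c * f + d * e))
    re-assoc = solve-∀
    half-assoc : ∀ a b c d e f →
      (a * c - + 4 * (b * d)) * f + (a * d + b * c) * e ≡
      a * (c * f + d * e) + b * (c * e - + 4 * (d * f))
    half-assoc = solve-∀

  ·-identityʳ : ∀ x → x · one ≡ x
  ·-identityʳ (gen a b) = cong₂ gen (solve (a ∷ b ∷ [])) (solve (a ∷ b ∷ []))

  pow-+ : ∀ g k l → pow g (k ℕ.+ l) ≡ pow g k · pow g l
  pow-+ g k zero    = trans (cong (pow g) (ℕₚ.+-identityʳ k)) (sym (·-identityʳ (pow g k)))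
  pow-+ g k (suc l) = begin
    pow g (k ℕ.+ suc l)       ≡⟨ cong (pow g) (ℕₚ.+-suc k l) ⟩
    pow g (k ℕ.+ l) · g       ≡⟨ cong (_· g) (pow-+ g k l) ⟩
    (pow g k · pow g l) · g   ≡⟨ ·-assoc (pow g k) (pow g l) g ⟩
    pow g k · pow g (suc l)   ∎

  re-·-odd : ∀ {x y} → Odd (re x) → Odd (re y) → Odd (re (x · y))
  re-·-odd {x} {y} odd-x odd-y = odd+even (odd-* odd-x odd-y) (∣m⇒∣-m (2∣4* (half x * half y)))

  re-pow-odd : ∀ {g} → Odd (re g) → ∀ k → Odd (re (pow g k))
  re-pow-odd odd-g zero    = + 0 , refl
  re-pow-odd {g} odd-g (suc k) = re-·-odd {pow g k} {g} (re-pow-odd odd-g k) odd-g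

  half-pow-double : ∀ g k → half (pow g (k ℕ.+ k)) ≡ + 2 * (re (pow g k) * half (pow g k))
  half-pow-double g k = trans (cong half (pow-+ g k k)) (twice (re (pow g k)) (half (pow g k)))
    where
    twice : ∀ a b → a * b + b * a ≡ + 2 * (a * b)
    twice = solve-∀

  -- For x = a + 2bi and y = c + 2di:  conj(x) · y = dot x y + 2 (cross x y) i.
  cross : Gen → Gen → ℤ
  cross x y = re x * half y - half x * re y

  dot : Gen → Gen → ℤ
  dot x y = re x * re y + + 4 * (half x * half y)

  dot-odd : ∀ {x y} → Odd (re x) → Odd (re y) → Odd (dot x y)
  dot-odd {x} {y} odd-x odd-y = odd+even (odd-* odd-x odd-y) (2∣4* (half x * half y))

  cross-antisym : ∀ x y → cross y x ≡ - cross x y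
  cross-antisym (gen a b) (gen c d) = swap a b c d
    where
    swap : ∀ a b c d → c * b - d * a ≡ - (a * d - b * c)
    swap = solve-∀

  cross-·ˡ : ∀ x y z → cross (x · y) z ≡ re y * cross x z - half y * dot x z
  cross-·ˡ (gen a b) (gen c d) (gen e f) = expand a b c d e f
    where
    expand : ∀ a b c d e f →
      (a * c - + 4 * (b * d)) * f - (a * d + b * c) * e ≡
      c * (a * f - b * e) - d * (a * e + + 4 * (b * f))
    expand = solve-∀

  cross-·ʳ : ∀ x z → cross x (x · z) ≡ norm x * half z
  cross-·ʳ (gen a b) (gen c d) = expand a b c d
    where
    expand : ∀ a b c d →
      a * (a * d + b * c) - b * (a * c - + 4 * (b * d)) ≡ (a * a + + 4 * (b * b)) * d
    expand = solve-∀

  GaussEquiv⇒∣2*cross : ∀ q x y → GaussEquiv q x y → + (4 ℕ.* q) ∣ + 2 * cross x y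
  GaussEquiv⇒∣2*cross q x y (N , ∣re , ∣half) =
    subst (+ (4 ℕ.* q) ∣_) (sym (expand N (re x) (half x) (re y) (half y)))
      (∣m∣n⇒∣m-n (∣n⇒∣m*n (+ 2 * half x) (∣ᵤ⇒∣ ∣re)) (∣n⇒∣m*n (re x) (∣ᵤ⇒∣ ∣half)))
    where
    expand : ∀ N a b c d →
      + 2 * (a * d - b * c) ≡ + 2 * b * (N * a - c) - a * (+ 2 * (N * b) - + 2 * d)
    expand = solve-∀

  ∣2*cross⇒GaussEquiv : ∀ q x y r → + (4 ℕ.* q) ∣ r * re x - + 1 →
                        + (4 ℕ.* q) ∣ + 2 * cross x y → GaussEquiv q x y
  ∣2*cross⇒GaussEquiv q x y r ∣r*a-1 ∣2*cross =
    r * re y ,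
    ∣⇒∣ᵤ (subst (M ∣_) (re-part r (re x) (re y)) (∣n⇒∣m*n (re y) ∣r*a-1)) ,
    ∣⇒∣ᵤ (subst (M ∣_) (half-part r (re x) (half x) (re y) (half y))
            (∣m∣n⇒∣m-n (∣n⇒∣m*n (+ 2 * half y) ∣r*a-1) (∣n⇒∣m*n r ∣2*cross)))
    where
    M = + (4 ℕ.* q)
    re-part : ∀ r a c → c * (r * a - + 1) ≡ r * c * a - c
    re-part = solve-∀
    half-part : ∀ r a b c d →
      + 2 * d * (r * a - + 1) - r * (+ 2 * (a * d - b * c)) ≡ + 2 * (r * c * b) - + 2 * d
    half-part = solve-∀

  2P∣cross-· : ∀ {P f u} x y z → cross x z ≡ f * P → half y ≡ P * u →
               Odd f → Odd u → Odd (re y) → Odd (dot x z) → + 2 * P ∣ cross (x · y) z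
  2P∣cross-· {P} {f} {u} x y z cross≡ half≡ odd-f odd-u odd-y odd-dot
    with 2∣odd-odd (odd-* odd-y odd-f) (odd-* odd-u odd-dot)
  ... | divides t even = divides t (begin
    cross (x · y) z                      ≡⟨ cross-·ˡ x y z ⟩
    re y * cross x z - half y * dot x z  ≡⟨ cong₂ (λ c h → re y * c - h * dot x z) cross≡ half≡ ⟩
    re y * (f * P) - P * u * dot x z     ≡⟨ factor (re y) f P u (dot x z) ⟩
    P * (re y * f - u * dot x z)         ≡⟨ cong (P *_) even ⟩
    P * (t * + 2)                        ≡⟨ regroup P t ⟩
    t * (+ 2 * P)                        ∎)
    where
    factor : ∀ a f P u d → a * (f * P) - P * u * d ≡ P * (a * f - u * d)
    factor = solve-∀
    regroup : ∀ P t → P * (t * + 2) ≡ t * (+ 2 * P)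
    regroup = solve-∀

  module _ {g : Gen} (g-re : Odd (re g)) (g-half : Odd (half g)) where

    half-pow-odd : ∀ e → Odd (half (pow g (suc (e ℕ.+ e))))
    half-pow-odd e = odd+even (odd-* (re-pow-odd g-re (e ℕ.+ e)) g-half)
      (∣m⇒∣m*n (re g) (subst (+ 2 ∣_) (sym (half-pow-double g e)) (∣m⇒∣m*n _ ∣-refl)))

    2^n∣half-pow⇒2^n∣exponent : ∀ n d → (+ 2) ^ n ∣ half (pow g d) → (+ 2) ^ n ∣ + d
    2^n∣half-pow⇒2^n∣exponent zero d _ = divides (+ d) (sym (*-identityʳ (+ d)))
    2^n∣half-pow⇒2^n∣exponent (suc n) d ∣half with ℕ-even⊎odd d
    ... | inj₂ (e , refl) = ⊥-elim (odd⇒¬even (half-pow-odd e) (∣-trans (2∣2^suc n) ∣half))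
    ... | inj₁ (e , refl) =
      subst ((+ 2) ^ suc n ∣_) (sym (trans (pos-+ e e) (twice (+ e))))
        (*-monoʳ-∣ (+ 2) (2^n∣half-pow⇒2^n∣exponent n e
          (2^n∣odd*x⇒2^n∣x n (re-pow-odd g-re e)
            (*-cancelˡ-∣ (+ 2) (subst ((+ 2) ^ suc n ∣_) (half-pow-double g e) ∣half)))))
      where
      twice : ∀ i → i + i ≡ + 2 * i
      twice = solve-∀

    half-pow-2^ : ∀ n → ∃[ u ] Odd u × half (pow g (2 ℕ.^ n)) ≡ (+ 2) ^ n * u
    half-pow-2^ zero = half g , g-half , +-identityʳ (+ 1 * half g)
    half-pow-2^ (suc n) with half-pow-2^ n
    ... | u , odd-u , half≡ = re (pow g m) * u , odd-* (re-pow-odd g-re m) odd-u , (begin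
      half (pow g (m ℕ.+ (m ℕ.+ 0)))         ≡⟨ cong (λ k → half (pow g (m ℕ.+ k))) (ℕₚ.+-identityʳ m) ⟩
      half (pow g (m ℕ.+ m))                 ≡⟨ half-pow-double g m ⟩
      + 2 * (re (pow g m) * half (pow g m))  ≡⟨ cong (λ h → + 2 * (re (pow g m) * h)) half≡ ⟩
      + 2 * (re (pow g m) * ((+ 2) ^ n * u)) ≡⟨ regroup (re (pow g m)) ((+ 2) ^ n) u ⟩
      (+ 2) ^ suc n * (re (pow g m) * u)     ∎)
      where
      m = 2 ℕ.^ n
      regroup : ∀ a P u → + 2 * (a * (P * u)) ≡ + 2 * P * (a * u)
      regroup = solve-∀

    powers-distinct-≤ : ∀ n {k l} → k ℕ.≤ l → l ℕ.< 2 ℕ.^ n →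
                        (+ 2) ^ n ∣ cross (pow g k) (pow g l) → k ≡ l
    powers-distinct-≤ n {k} k≤l l< ∣cross with ℕₚ.m≤n⇒∃[o]m+o≡n k≤l
    ... | d , refl = sym (trans (cong (k ℕ.+_) d≡0) (ℕₚ.+-identityʳ k))
      where
      x = pow g k
      odd-norm : Odd (norm x)
      odd-norm = dot-odd {x} {x} (re-pow-odd g-re k) (re-pow-odd g-re k)
      ∣half : (+ 2) ^ n ∣ half (pow g d)
      ∣half = 2^n∣odd*x⇒2^n∣x n odd-norm
        (subst ((+ 2) ^ n ∣_) (trans (cong (cross x) (pow-+ g k d)) (cross-·ʳ x (pow g d))) ∣cross)
      d≡0 : d ≡ 0
      d≡0 = ∣∧<⇒≡0 (ℕₚ.≤-<-trans (ℕₚ.m≤n+m d k) l<)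
              (subst (_∣ + d) (sym (pos-2^ n)) (2^n∣half-pow⇒2^n∣exponent n d ∣half))

    powers-distinct : ∀ n {k l} → k ℕ.< 2 ℕ.^ n → l ℕ.< 2 ℕ.^ n →
                      (+ 2) ^ n ∣ cross (pow g k) (pow g l) → k ≡ l
    powers-distinct n {k} {l} k< l< ∣cross with ℕₚ.≤-total k l
    ... | inj₁ k≤l = powers-distinct-≤ n k≤l l< ∣cross
    ... | inj₂ l≤k = sym (powers-distinct-≤ n l≤k k<
      (subst ((+ 2) ^ n ∣_) (sym (cross-antisym (pow g k) (pow g l))) (∣m⇒∣-m ∣cross)))

    powers-reach : ∀ {γ} → Odd (re γ) → ∀ n → ∃[ k ] k ℕ.< 2 ℕ.^ n × (+ 2) ^ n ∣ cross (pow g k) γ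
    powers-reach {γ} odd-γ zero = 0 , s≤s z≤n , divides (cross one γ) (sym (*-identityʳ _))
    powers-reach {γ} odd-γ (suc n) with powers-reach odd-γ n
    ... | k , k< , divides f cross≡ with even⊎odd f
    ...   | inj₁ (divides t refl) =
      k , ℕₚ.<-≤-trans k< (ℕₚ.m≤m+n _ _) , divides t (trans cross≡ (*-assoc t (+ 2) _))
    ...   | inj₂ odd-f with half-pow-2^ n
    ...     | u , odd-u , half≡ =
      k ℕ.+ 2 ℕ.^ n , ℕₚ.+-mono-<-≤ k< (ℕₚ.m≤m+n _ 0) ,
      subst (λ x → (+ 2) ^ suc n ∣ cross x γ) (sym (pow-+ g k (2 ℕ.^ n)))
        (2P∣cross-· (pow g k) (pow g (2 ℕ.^ n)) γ cross≡ half≡ odd-f odd-u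
          (re-pow-odd g-re (2 ℕ.^ n)) (dot-odd {pow g k} {γ} (re-pow-odd g-re k) odd-γ))

    generates : ∀ m → GeneratesWithOrder (2 ℕ.^ m) (2 ℕ.* 2 ℕ.^ m) g
    generates m = surjective , injective
      where
      modulus : + (4 ℕ.* 2 ℕ.^ m) ≡ (+ 2) ^ suc (suc m)
      modulus = trans (cong +_ (ℕₚ.*-assoc 2 2 (2 ℕ.^ m))) (pos-2^ (suc (suc m)))
      surjective : (I : OddNormIdeal) →
                   ∃[ k ] k ℕ.< 2 ℕ.* 2 ℕ.^ m × GaussEquiv (2 ℕ.^ m) (pow g k) (proj₁ I)
      surjective (γ , odd-γ) with powers-reach (oddInt⇒odd odd-γ) (suc m)
      ... | k , k< , ∣cross with odd-invertible-mod-2^ (re-pow-odd g-re k) (suc m)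
      ...   | r , ∣r*a-1 = k , k< , ∣2*cross⇒GaussEquiv (2 ℕ.^ m) (pow g k) γ r
        (subst (_∣ r * re (pow g k) - + 1) (sym modulus) ∣r*a-1)
        (subst (_∣ + 2 * cross (pow g k) γ) (sym modulus) (*-monoʳ-∣ (+ 2) ∣cross))
      injective : ∀ k l → k ℕ.< 2 ℕ.* 2 ℕ.^ m → l ℕ.< 2 ℕ.* 2 ℕ.^ m →
                  GaussEquiv (2 ℕ.^ m) (pow g k) (pow g l) → k ≡ l
      injective k l k< l< k~l = powers-distinct (suc m) k< l< (*-cancelˡ-∣ (+ 2)
        (subst (_∣ + 2 * cross (pow g k) (pow g l)) modulus
          (GaussEquiv⇒∣2*cross (2 ℕ.^ m) (pow g k) (pow g l) k~l)))

  8∣norm-5⇒half-odd : ∀ x → Odd (re x) → + 8 ∣ norm x - + 5 → Odd (half x)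
  8∣norm-5⇒half-odd x odd-re 8∣norm-5 = 2∣x*x-1⇒odd (half x) (*-cancelˡ-∣ (+ 4) {+ 2}
      (subst (+ 8 ∣_) (difference (re x) (half x)) (∣m∣n⇒∣m-n 8∣norm-5 (8∣odd*odd-1 odd-re))))
    where
    difference : ∀ a b → a * a + + 4 * (b * b) - + 5 - (a * a - + 1) ≡ + 4 * (b * b - + 1)
    difference = solve-∀

  1+2i-generates : ∀ m → GaussGroupCyclicOfOrder (2 ℕ.^ m) (2 ℕ.* 2 ℕ.^ m)
  1+2i-generates m = (gen (+ 1) (+ 1) , odd⇒oddInt (+ 0 , refl)) , generates (+ 0 , refl) (+ 0 , refl) m

  norm≡5-mod-8⇒generates : ∀ m (I : OddNormIdeal) → + 8 ∣ᵤ norm (proj₁ I) - + 5 →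
                           GeneratesWithOrder (2 ℕ.^ m) (2 ℕ.* 2 ℕ.^ m) (proj₁ I)
  norm≡5-mod-8⇒generates m (x , odd-re) 8∣norm-5 =
    generates (oddInt⇒odd odd-re) (8∣norm-5⇒half-odd x (oddInt⇒odd odd-re) (∣ᵤ⇒∣ 8∣norm-5)) m

open import Data.Nat using (ℕ; _^_; _*_)
open import Data.Integer using (+_; _-_)
open import Data.Integer.Divisibility using (_∣_)
open import Data.Product using (_×_; proj₁; _,_)

theorem3p2 : (m : ℕ) →
    GaussGroupCyclicOfOrder (2 ^ m) (2 * 2 ^ m)
    × ((I : OddNormIdeal) → + 8 ∣ (norm (proj₁ I) - + 5) →
         GeneratesWithOrder (2 ^ m) (2 * 2 ^ m) (proj₁ I))
theorem3p2 m = 1+2i-generates m , norm≡5-mod-8⇒generates m
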